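{- Let $m\geq 1$ and $Z\subset\{0,\dots,m-1\}$. Then there exists $Q\subset[2^m]$ such that $BT_m[Q]$ is a perfect rooted binary tree of height $|Z|$, and the depth in $BT_m$ of each non-leaf vertex of $BT_m[Q]$ belongs to $Z$.
   Context: $BT_m$ is the perfect rooted binary tree of height $m$ ($BT_0$ a single vertex; $BT_m$ obtained by attaching two children to each leaf of $BT_{m-1}$), with leaves identified with $1,\dots,2^m$ from left to right (children of leaf $i$ of $BT_{m-1}$ become $2i-1,2i$). Depth is distance from the root; $w$ is an ancestor of $v$ if $w$ lies on the path from $v$ to the root (including $v$). For a vertex set $S$, $\delta(S)$ is the common ancestor of all elements of $S$ of largest depth, $\delta(x,y)=\delta(\{x,y\})$. For nonempty $X$, $BT_m[X]$ is the rooted tree with vertex set $\{\delta(v,w):v,w\in X\}$ and root $\delta(X)$, in which distinct $x,y$ are adjacent iff one is an ancestor of the other and no other vertex of the set is a descendant of one and an ancestor of the other. -}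

module Defs where

open import Data.Nat using (ℕ; zero; suc; _≤_; _^_; _/_; _%_; _≡ᵇ_)
open import Data.Bool using (Bool)
open import Data.Fin using (Fin; toℕ)
open import Data.Fin.Subset using (Subset; _∈_)
open import Data.List using (List; []; _∷_; _++_; [_]; length)
open import Data.List.Membership.Propositional renaming (_∈_ to _∈ₗ_)
open import Data.Product using (Σ; ∃; ∃-syntax; _×_)
open import Data.Sum using (_⊎_)
open import Relation.Binary.PropositionalEquality using (_≡_; _≢_)
open import Relation.Nullary using (¬_)
open import Function.Bundles using (_⇔_)

-- Vertices of BT_m are encoded as root-to-vertex paths: lists of bits
-- (false = left child, true = right child) of length ≤ m.
-- Depth of a vertex = length of its path.

depth : List Bool → ℕ
depth = length

Anc : List Bool → List Bool → Set
Anc w v = ∃[ s ] (w ++ s ≡ v)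

-- Leaf numbering (0-based: leaf i+1 of the paper is index i here).
-- leaf of BT_0 is the root; in BT_{m+1}, the children of leaf j of BT_m
-- are 2j and 2j+1 (0-based), i.e. leaf n has parent leaf (n / 2) and is
-- its left/right child according to n % 2.
leafPath : ℕ → ℕ → List Bool
leafPath zero    n = []
leafPath (suc m) n = leafPath m (n / 2) ++ [ n % 2 ≡ᵇ 1 ]

leaf : (m : ℕ) → Fin (2 ^ m) → List Bool
leaf m i = leafPath m (toℕ i)

IsDelta : (List Bool → Set) → List Bool → Set
IsDelta S x = (∀ s → S s → Anc x s)
            × (∀ y → (∀ s → S s → Anc y s) → depth y ≤ depth x)

Pair : List Bool → List Bool → List Bool → Set
Pair v w s = (s ≡ v) ⊎ (s ≡ w)

LeafSet : (m : ℕ) → List (Fin (2 ^ m)) → List Bool → Set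
LeafSet m Q s = ∃[ i ] (i ∈ₗ Q × s ≡ leaf m i)

-- Vertex set of BT_m[Q]:  { δ(v,w) : v,w ∈ Q }
InV : (m : ℕ) → List (Fin (2 ^ m)) → List Bool → Set
InV m Q x = ∃[ i ] ∃[ j ] (i ∈ₗ Q × j ∈ₗ Q × IsDelta (Pair (leaf m i) (leaf m j)) x)

IsRoot : (m : ℕ) → List (Fin (2 ^ m)) → List Bool → Set
IsRoot m Q x = IsDelta (LeafSet m Q) x

StrictlyBetween : List Bool → List Bool → List Bool → Set
StrictlyBetween x z y = (Anc x z × Anc z y) ⊎ (Anc y z × Anc z x)

AdjQ : (m : ℕ) → List (Fin (2 ^ m)) → List Bool → List Bool → Set
AdjQ m Q x y =
  InV m Q x × InV m Q y × x ≢ y × (Anc x y ⊎ Anc y x)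
  × (¬ (∃[ z ] (InV m Q z × z ≢ x × z ≢ y × StrictlyBetween x z y)))

NonLeafQ : (m : ℕ) → List (Fin (2 ^ m)) → List Bool → Set
NonLeafQ m Q x = InV m Q x × ∃[ y ] (AdjQ m Q x y × Anc x y)

AdjBT : List Bool → List Bool → Set
AdjBT u u' = (∃[ b ] (u' ≡ u ++ [ b ])) ⊎ (∃[ b ] (u ≡ u' ++ [ b ]))

-- BT_m[Q] is a perfect rooted binary tree of height k, i.e. it is isomorphic
-- as a rooted tree to BT_k: there is a bijection f from the vertices of BT_k
-- onto the vertex set of BT_m[Q], mapping root to root and preserving and
-- reflecting adjacency.
IsPerfectOfHeight : (m : ℕ) → List (Fin (2 ^ m)) → ℕ → Set
IsPerfectOfHeight m Q k =
  Σ (List Bool → List Bool) λ f → (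
      (∀ u → length u ≤ k → InV m Q (f u))
    × (∀ x → InV m Q x → ∃[ u ] (length u ≤ k × f u ≡ x))
    × (∀ u u' → length u ≤ k → length u' ≤ k → f u ≡ f u' → u ≡ u')
    × IsRoot m Q (f [])
    × (∀ u u' → length u ≤ k → length u' ≤ k → (AdjBT u u' ⇔ AdjQ m Q (f u) (f u'))))

DepthIn : (m : ℕ) → Subset m → List Bool → Set
DepthIn m Z x = ∃[ i ] (i ∈ Z × toℕ i ≡ depth x)

-- Let k = |Z|. The map spread Z sends a vertex u of BT_k to the vertex of BT_m
-- reached by descending from the root, taking the next bit of u at each depth
-- in Z and stepping to the left child at each depth outside Z. It preserves
-- longest common prefixes (meets) and is injective on BT_k. Taking for Q the
-- images of the leaves of BT_k, every vertex of BT_k is the meet of two of its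
-- leaves, so the vertices δ(v,w) of BT_m[Q] are exactly the images of BT_k and
-- spread Z is an isomorphism of rooted trees. The non-leaf vertices of BT_m[Q]
-- are the images of vertices u with |u| < k, whose depth is the |u|-th
-- element of Z.
module Submission where

open import Defs
open import Data.Nat using (ℕ; zero; suc; _+_; _*_; _∸_; _^_; _≤_; _<_; _/_; _%_; _≡ᵇ_; z≤n; s≤s)
open import Data.Nat.Properties
open import Data.Nat.DivMod using (+-distrib-/-∣ʳ; m*n/n≡m; [m+kn]%n≡m%n)
open import Data.Nat.Divisibility using (divides-refl)
open import Data.Bool using (Bool; true; false)
open import Data.Fin using (Fin; toℕ; fromℕ<) renaming (zero to fzero; suc to fsuc)
open import Data.Fin.Properties using (toℕ-fromℕ<)
open import Data.Fin.Subset using (Subset; ∣_∣)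
open import Data.Vec using ([]; _∷_; here; there)
open import Data.List using (List; []; _∷_; _++_; [_]; length; map; replicate; reverse; allFin)
open import Data.List.Properties
  using (∷-injective; ∷-injectiveʳ; ++-cancelˡ; ++-assoc; ++-identityʳ; length-++;
         length-replicate; length-reverse; reverse-involutive; unfold-reverse)
open import Data.List.Membership.Propositional renaming (_∈_ to _∈ₗ_)
open import Data.List.Membership.Propositional.Properties using (∈-map⁺; ∈-map⁻; ∈-allFin)
open import Data.Product using (∃-syntax; _×_; _,_; proj₁; proj₂)
open import Data.Sum using (_⊎_; inj₁; inj₂; swap)
open import Data.Empty using (⊥-elim)
open import Relation.Nullary using (¬_)
open import Relation.Binary.PropositionalEquality
  using (_≡_; _≢_; refl; sym; trans; cong; cong₂; subst; subst₂; module ≡-Reasoning)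
open import Function.Bundles using (_⇔_; mk⇔)

Anc-length-≤ : ∀ {w v} → Anc w v → length w ≤ length v
Anc-length-≤ {w} (s , refl) = subst (length w ≤_) (sym (length-++ w)) (m≤m+n _ _)

Anc-refl : ∀ w → Anc w w
Anc-refl w = [] , ++-identityʳ w

Anc-[] : ∀ v → Anc [] v
Anc-[] v = v , refl

Anc-∷⁺ : ∀ {a x s} → Anc x s → Anc (a ∷ x) (a ∷ s)
Anc-∷⁺ {a} (t , e) = t , cong (a ∷_) e

Anc-∷⁻ : ∀ {a b x s} → Anc (a ∷ x) (b ∷ s) → a ≡ b × Anc x s
Anc-∷⁻ (t , e) = proj₁ (∷-injective e) , (t , ∷-injectiveʳ e)

Anc-trans : ∀ {u v w} → Anc u v → Anc v w → Anc u w
Anc-trans {u} (s , refl) (t , refl) = s ++ t , sym (++-assoc u s t)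

Anc-unique : ∀ {x y s} → Anc x s → Anc y s → length x ≡ length y → x ≡ y
Anc-unique {[]}    {[]}    _ _ _ = refl
Anc-unique {a ∷ x} {b ∷ y} {c ∷ s} hx hy e
  with refl , hx′ ← Anc-∷⁻ hx | refl , hy′ ← Anc-∷⁻ hy =
  cong (a ∷_) (Anc-unique hx′ hy′ (suc-injective e))

length-∷ʳ : ∀ (u : List Bool) b → length (u ++ [ b ]) ≡ suc (length u)
length-∷ʳ u b = trans (length-++ u) (+-comm (length u) 1)

≢-++-∷ : ∀ (u : List Bool) {b s} → u ≢ u ++ b ∷ s
≢-++-∷ u e = m≢1+n+m (length u) (trans (cong length e) (trans (length-++ u) (+-comm (length u) _)))

Anc-between-∷ʳ : ∀ {u w b} → Anc u w → Anc w (u ++ [ b ]) → w ≡ u ⊎ w ≡ u ++ [ b ]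
Anc-between-∷ʳ {u} (s , refl) (t , e) with ++-cancelˡ u (s ++ t) _ (trans (sym (++-assoc u s t)) e)
Anc-between-∷ʳ {u} ([] , refl)    (t , e) | _    = inj₁ (++-identityʳ u)
Anc-between-∷ʳ {u} (c ∷ [] , refl) (t , e) | refl = inj₂ refl

lcp : List Bool → List Bool → List Bool
lcp []          _           = []
lcp (_ ∷ _)     []          = []
lcp (false ∷ p) (false ∷ q) = false ∷ lcp p q
lcp (true ∷ p)  (true ∷ q)  = true ∷ lcp p q
lcp (false ∷ _) (true ∷ _)  = []
lcp (true ∷ _)  (false ∷ _) = []

lcp-Ancˡ : ∀ p q → Anc (lcp p q) p
lcp-Ancˡ []          _           = Anc-[] _
lcp-Ancˡ (_ ∷ _)     []          = Anc-[] _
lcp-Ancˡ (false ∷ p) (false ∷ q) = Anc-∷⁺ (lcp-Ancˡ p q)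
lcp-Ancˡ (true ∷ p)  (true ∷ q)  = Anc-∷⁺ (lcp-Ancˡ p q)
lcp-Ancˡ (false ∷ _) (true ∷ _)  = Anc-[] _
lcp-Ancˡ (true ∷ _)  (false ∷ _) = Anc-[] _

lcp-Ancʳ : ∀ p q → Anc (lcp p q) q
lcp-Ancʳ []          _           = Anc-[] _
lcp-Ancʳ (_ ∷ _)     []          = Anc-[] _
lcp-Ancʳ (false ∷ p) (false ∷ q) = Anc-∷⁺ (lcp-Ancʳ p q)
lcp-Ancʳ (true ∷ p)  (true ∷ q)  = Anc-∷⁺ (lcp-Ancʳ p q)
lcp-Ancʳ (false ∷ _) (true ∷ _)  = Anc-[] _
lcp-Ancʳ (true ∷ _)  (false ∷ _) = Anc-[] _

lcp-greatest : ∀ {y} p q → Anc y p → Anc y q → Anc y (lcp p q)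
lcp-greatest {[]}    _       _       _  _  = Anc-[] _
lcp-greatest {_ ∷ _} []      _       (_ , ()) _
lcp-greatest {_ ∷ _} (_ ∷ _) []      _  (_ , ())
lcp-greatest {c ∷ y} (a ∷ p) (b ∷ q) hp hq
  with refl , hp′ ← Anc-∷⁻ hp | refl , hq′ ← Anc-∷⁻ hq with c
... | false = Anc-∷⁺ (lcp-greatest p q hp′ hq′)
... | true  = Anc-∷⁺ (lcp-greatest p q hp′ hq′)

lcp-idem : ∀ p → lcp p p ≡ p
lcp-idem []          = refl
lcp-idem (false ∷ p) = cong (false ∷_) (lcp-idem p)
lcp-idem (true ∷ p)  = cong (true ∷_) (lcp-idem p)

lcp-fork : ∀ u r r′ → lcp (u ++ false ∷ r) (u ++ true ∷ r′) ≡ u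
lcp-fork []          _ _  = refl
lcp-fork (false ∷ u) r r′ = cong (false ∷_) (lcp-fork u r r′)
lcp-fork (true ∷ u)  r r′ = cong (true ∷_) (lcp-fork u r r′)

Anc⇒lcp≡ : ∀ {u v} → Anc u v → lcp u v ≡ u
Anc⇒lcp≡ {u} h = Anc-unique (lcp-Ancˡ u _) (Anc-refl u)
  (≤-antisym (Anc-length-≤ (lcp-Ancˡ u _)) (Anc-length-≤ (lcp-greatest u _ (Anc-refl u) h)))

lcp≡⇒Anc : ∀ {u v} → lcp u v ≡ u → Anc u v
lcp≡⇒Anc {u} {v} e = subst (λ w → Anc w v) e (lcp-Ancʳ u v)

fork : ∀ k u → length u ≤ k → ∃[ a ] ∃[ b ] (length a ≡ k × length b ≡ k × lcp a b ≡ u)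
fork k u u≤k with m≤n⇒m<n∨m≡n u≤k
... | inj₂ e  = u , u , e , e , lcp-idem u
... | inj₁ u<k = u ++ false ∷ r , u ++ true ∷ r , length-extension , length-extension , lcp-fork u r r
  where
  r : List Bool
  r = replicate (k ∸ suc (length u)) false
  length-extension : ∀ {b} → length (u ++ b ∷ r) ≡ k
  length-extension = trans (length-++ u)
    (trans (+-suc (length u) _) (trans (cong (λ n → suc (length u + n)) (length-replicate _)) (m+[n∸m]≡n u<k)))

IsDelta-Pair-lcp : ∀ p q → IsDelta (Pair p q) (lcp p q)
IsDelta-Pair-lcp p q =
  (λ { _ (inj₁ refl) → lcp-Ancˡ p q ; _ (inj₂ refl) → lcp-Ancʳ p q }) ,
  λ y h → Anc-length-≤ (lcp-greatest p q (h p (inj₁ refl)) (h q (inj₂ refl)))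

IsDelta-unique : ∀ {S : List Bool → Set} {x y s} → S s → IsDelta S x → IsDelta S y → x ≡ y
IsDelta-unique s∈S (x-anc , x-max) (y-anc , y-max) =
  Anc-unique (x-anc _ s∈S) (y-anc _ s∈S) (≤-antisym (y-max _ x-anc) (x-max _ y-anc))

bit : Bool → ℕ
bit false = 0
bit true  = 1

-- Little-endian: the first bit is the least significant one.
fromBits : List Bool → ℕ
fromBits []      = 0
fromBits (b ∷ r) = bit b + fromBits r * 2

fromBits< : ∀ r → fromBits r < 2 ^ length r
fromBits< []      = s≤s z≤n
fromBits< (b ∷ r) = begin-strict
  bit b + fromBits r * 2 <⟨ bit+<1+ b ⟩
  suc (fromBits r) * 2   ≤⟨ *-monoˡ-≤ 2 (fromBits< r) ⟩
  2 ^ length r * 2       ≡⟨ *-comm (2 ^ length r) 2 ⟩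
  2 ^ length (b ∷ r)     ∎
  where
  open ≤-Reasoning
  bit+<1+ : ∀ b → bit b + fromBits r * 2 < suc (fromBits r) * 2
  bit+<1+ false = s≤s (n≤1+n _)
  bit+<1+ true  = ≤-refl

[bit+x*2]/2≡x : ∀ b x → (bit b + x * 2) / 2 ≡ x
[bit+x*2]/2≡x b x = begin
  (bit b + x * 2) / 2   ≡⟨ +-distrib-/-∣ʳ (bit b) (divides-refl x) ⟩
  bit b / 2 + x * 2 / 2 ≡⟨ cong₂ _+_ (bit/2≡0 b) (m*n/n≡m x 2) ⟩
  x                     ∎
  where
  open ≡-Reasoning
  bit/2≡0 : ∀ b → bit b / 2 ≡ 0
  bit/2≡0 false = refl
  bit/2≡0 true  = refl

[bit+x*2]%2≡ᵇ1≡b : ∀ b x → ((bit b + x * 2) % 2 ≡ᵇ 1) ≡ b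
[bit+x*2]%2≡ᵇ1≡b b x = trans (cong (_≡ᵇ 1) ([m+kn]%n≡m%n (bit b) x 2)) (bit%2≡ᵇ1 b)
  where
  bit%2≡ᵇ1 : ∀ b → (bit b % 2 ≡ᵇ 1) ≡ b
  bit%2≡ᵇ1 false = refl
  bit%2≡ᵇ1 true  = refl

leafPath-fromBits : ∀ r → leafPath (length r) (fromBits r) ≡ reverse r
leafPath-fromBits []      = refl
leafPath-fromBits (b ∷ r) = begin
  leafPath (length r) ((bit b + fromBits r * 2) / 2) ++ [ (bit b + fromBits r * 2) % 2 ≡ᵇ 1 ]
    ≡⟨ cong₂ (λ n c → leafPath (length r) n ++ [ c ]) ([bit+x*2]/2≡x b (fromBits r)) ([bit+x*2]%2≡ᵇ1≡b b (fromBits r)) ⟩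
  leafPath (length r) (fromBits r) ++ [ b ]
    ≡⟨ cong (_++ [ b ]) (leafPath-fromBits r) ⟩
  reverse r ++ [ b ]
    ≡⟨ unfold-reverse b r ⟨
  reverse (b ∷ r) ∎
  where open ≡-Reasoning

length-leafPath : ∀ m n → length (leafPath m n) ≡ m
length-leafPath zero    n = refl
length-leafPath (suc m) n = trans (length-∷ʳ (leafPath m (n / 2)) _) (cong suc (length-leafPath m (n / 2)))

leafIndex : ∀ {m} (p : List Bool) → length p ≡ m → Fin (2 ^ m)
leafIndex p refl = fromℕ< (subst (λ n → fromBits (reverse p) < 2 ^ n) (length-reverse p) (fromBits< (reverse p)))

leaf-leafIndex : ∀ {m} (p : List Bool) (e : length p ≡ m) → leaf m (leafIndex p e) ≡ p
leaf-leafIndex p refl = begin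
  leafPath (length p) (toℕ (leafIndex p refl))   ≡⟨ cong (leafPath (length p)) (toℕ-fromℕ< _) ⟩
  leafPath (length p) (fromBits (reverse p))     ≡⟨ cong (λ n → leafPath n (fromBits (reverse p))) (length-reverse p) ⟨
  leafPath (length (reverse p)) (fromBits (reverse p)) ≡⟨ leafPath-fromBits (reverse p) ⟩
  reverse (reverse p)                            ≡⟨ reverse-involutive p ⟩
  p                                              ∎
  where open ≡-Reasoning

module InducedTree
  (m : ℕ) (Q : List (Fin (2 ^ m))) (k : ℕ) (f : List Bool → List Bool)
  (f-injective : ∀ u v → length u ≤ k → length v ≤ k → f u ≡ f v → u ≡ v)
  (f-Anc⁺ : ∀ {u v} → Anc u v → Anc (f u) (f v))
  (f-Anc⁻ : ∀ {u v} → length u ≤ k → length v ≤ k → Anc (f u) (f v) → Anc u v)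
  (image⁺ : ∀ u → length u ≤ k → InV m Q (f u))
  (image⁻ : ∀ x → InV m Q x → ∃[ u ] (length u ≤ k × f u ≡ x))
  where

  AdjQ-sym : ∀ {x y} → AdjQ m Q x y → AdjQ m Q y x
  AdjQ-sym (x∈ , y∈ , x≢y , related , nothing-between) =
    y∈ , x∈ , (λ e → x≢y (sym e)) , swap related ,
    λ { (z , z∈ , z≢y , z≢x , between) → nothing-between (z , z∈ , z≢x , z≢y , swap between) }

  child-adjacent : ∀ u b → length (u ++ [ b ]) ≤ k → AdjQ m Q (f u) (f (u ++ [ b ]))
  child-adjacent u b ub≤k =
    image⁺ u u≤k , image⁺ ub ub≤k , fu≢fub , inj₁ (f-Anc⁺ ([ b ] , refl)) , nothing-between
    where
    ub : List Bool
    ub = u ++ [ b ]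
    u≤k : length u ≤ k
    u≤k = ≤-trans (Anc-length-≤ {u} ([ b ] , refl)) ub≤k
    fu≢fub : f u ≢ f ub
    fu≢fub e = ≢-++-∷ u (f-injective u ub u≤k ub≤k e)
    nothing-between : ¬ (∃[ z ] (InV m Q z × z ≢ f u × z ≢ f ub × StrictlyBetween (f u) z (f ub)))
    nothing-between (z , z∈ , z≢fu , z≢fub , between) with image⁻ z z∈
    ... | w , w≤k , refl with between
    ... | inj₁ (u-w , w-ub) with Anc-between-∷ʳ (f-Anc⁻ u≤k w≤k u-w) (f-Anc⁻ w≤k ub≤k w-ub)
    ...   | inj₁ refl = z≢fu refl
    ...   | inj₂ refl = z≢fub refl
    nothing-between (z , z∈ , z≢fu , z≢fub , between) | w , w≤k , refl | inj₂ (ub-w , w-u) =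
      1+n≰n (subst (_≤ length u) (length-∷ʳ u b)
        (Anc-length-≤ (Anc-trans (f-Anc⁻ ub≤k w≤k ub-w) (f-Anc⁻ w≤k u≤k w-u))))

  adjacent-descendant-is-child : ∀ u v → length u ≤ k → length v ≤ k → Anc u v →
    AdjQ m Q (f u) (f v) → ∃[ b ] (v ≡ u ++ [ b ])
  adjacent-descendant-is-child u _ _ _ ([] , refl) (_ , _ , fu≢fv , _) =
    ⊥-elim (fu≢fv (cong f (sym (++-identityʳ u))))
  adjacent-descendant-is-child u _ _ _ (c ∷ [] , refl) _ = c , refl
  adjacent-descendant-is-child u v u≤k v≤k (c ∷ d ∷ s , refl) (_ , _ , _ , _ , nothing-between) =
    ⊥-elim (nothing-between (f w , image⁺ w w≤k , fw≢fu , fw≢fv , inj₁ (f-Anc⁺ ([ c ] , refl) , f-Anc⁺ w-v)))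
    where
    w : List Bool
    w = u ++ [ c ]
    w-v : Anc w v
    w-v = d ∷ s , ++-assoc u [ c ] (d ∷ s)
    w≤k : length w ≤ k
    w≤k = ≤-trans (Anc-length-≤ w-v) v≤k
    fw≢fu : f w ≢ f u
    fw≢fu e = ≢-++-∷ u (sym (f-injective w u w≤k u≤k e))
    fw≢fv : f w ≢ f v
    fw≢fv e = ≢-++-∷ w (trans (f-injective w v w≤k v≤k e) (sym (proj₂ w-v)))

  AdjBT⇔AdjQ : ∀ u v → length u ≤ k → length v ≤ k → AdjBT u v ⇔ AdjQ m Q (f u) (f v)
  AdjBT⇔AdjQ u v u≤k v≤k = mk⇔ to from
    where
    to : AdjBT u v → AdjQ m Q (f u) (f v)
    to (inj₁ (b , refl)) = child-adjacent u b v≤k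
    to (inj₂ (b , refl)) = AdjQ-sym (child-adjacent v b u≤k)
    from : AdjQ m Q (f u) (f v) → AdjBT u v
    from adj@(_ , _ , _ , inj₁ fu-fv , _) =
      inj₁ (adjacent-descendant-is-child u v u≤k v≤k (f-Anc⁻ u≤k v≤k fu-fv) adj)
    from adj@(_ , _ , _ , inj₂ fv-fu , _) =
      inj₂ (adjacent-descendant-is-child v u v≤k u≤k (f-Anc⁻ v≤k u≤k fv-fu) (AdjQ-sym adj))

  isPerfect : IsRoot m Q (f []) → IsPerfectOfHeight m Q k
  isPerfect root = f , image⁺ , image⁻ , f-injective , root , AdjBT⇔AdjQ

  NonLeafQ-image : ∀ x → NonLeafQ m Q x → ∃[ u ] (length u < k × f u ≡ x)
  NonLeafQ-image x (x∈ , y , adj , x-y) with image⁻ x x∈ | image⁻ y (proj₁ (proj₂ adj))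
  ... | u , u≤k , refl | v , v≤k , refl
    with b , refl ← adjacent-descendant-is-child u v u≤k v≤k (f-Anc⁻ u≤k v≤k x-y) adj =
    u , subst (_≤ k) (length-∷ʳ u b) v≤k , refl

spread : ∀ {m} → Subset m → List Bool → List Bool
spread []          _       = []
spread (true ∷ Z)  []      = []
spread (true ∷ Z)  (b ∷ u) = b ∷ spread Z u
spread (false ∷ Z) u       = false ∷ spread Z u

spread-lcp : ∀ {m} (Z : Subset m) p q → spread Z (lcp p q) ≡ lcp (spread Z p) (spread Z q)
spread-lcp []          p           q           = refl
spread-lcp (false ∷ Z) p           q           = cong (false ∷_) (spread-lcp Z p q)
spread-lcp (true ∷ Z)  []          q           = refl
spread-lcp (true ∷ Z)  (_ ∷ _)     []          = refl
spread-lcp (true ∷ Z)  (false ∷ p) (false ∷ q) = cong (false ∷_) (spread-lcp Z p q)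
spread-lcp (true ∷ Z)  (true ∷ p)  (true ∷ q)  = cong (true ∷_) (spread-lcp Z p q)
spread-lcp (true ∷ Z)  (false ∷ _) (true ∷ _)  = refl
spread-lcp (true ∷ Z)  (true ∷ _)  (false ∷ _) = refl

spread-injective : ∀ {m} (Z : Subset m) u v → length u ≤ ∣ Z ∣ → length v ≤ ∣ Z ∣ →
  spread Z u ≡ spread Z v → u ≡ v
spread-injective []          []      []      _         _         _ = refl
spread-injective (false ∷ Z) u       v       u≤        v≤        e = spread-injective Z u v u≤ v≤ (∷-injectiveʳ e)
spread-injective (true ∷ Z)  []      []      _         _         _ = refl
spread-injective (true ∷ Z)  (a ∷ u) (b ∷ v) (s≤s u≤) (s≤s v≤) e =
  cong₂ _∷_ (proj₁ (∷-injective e)) (spread-injective Z u v u≤ v≤ (∷-injectiveʳ e))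

length-spread : ∀ {m} (Z : Subset m) a → length a ≡ ∣ Z ∣ → length (spread Z a) ≡ m
length-spread []          _       _ = refl
length-spread (false ∷ Z) a       e = cong suc (length-spread Z a e)
length-spread (true ∷ Z)  (_ ∷ a) e = cong suc (length-spread Z a (suc-injective e))

spread-Anc⁺ : ∀ {m} (Z : Subset m) {u v} → Anc u v → Anc (spread Z u) (spread Z v)
spread-Anc⁺ Z {u} {v} u-v =
  lcp≡⇒Anc (trans (sym (spread-lcp Z u v)) (cong (spread Z) (Anc⇒lcp≡ u-v)))

spread-Anc⁻ : ∀ {m} (Z : Subset m) {u v} → length u ≤ ∣ Z ∣ → length v ≤ ∣ Z ∣ →
  Anc (spread Z u) (spread Z v) → Anc u v
spread-Anc⁻ Z {u} {v} u≤ v≤ fu-fv = lcp≡⇒Anc (spread-injective Z (lcp u v) u lcp≤ u≤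
  (trans (spread-lcp Z u v) (Anc⇒lcp≡ fu-fv)))
  where
  lcp≤ : length (lcp u v) ≤ ∣ Z ∣
  lcp≤ = ≤-trans (Anc-length-≤ (lcp-Ancˡ u v)) u≤

spread-DepthIn : ∀ {m} (Z : Subset m) u → length u < ∣ Z ∣ → DepthIn m Z (spread Z u)
spread-DepthIn (false ∷ Z) u       u<
  with i , i∈Z , e ← spread-DepthIn Z u u< = fsuc i , there i∈Z , cong suc e
spread-DepthIn (true ∷ Z)  []      _ = fzero , here , refl
spread-DepthIn (true ∷ Z)  (_ ∷ u) (s≤s u<)
  with i , i∈Z , e ← spread-DepthIn Z u u< = fsuc i , there i∈Z , cong suc e

module SpreadTree (m : ℕ) (Z : Subset m) where

  k : ℕ
  k = ∣ Z ∣

  length-spread-leaf : ∀ i → length (spread Z (leaf k i)) ≡ m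
  length-spread-leaf i = length-spread Z (leaf k i) (length-leafPath k (toℕ i))

  spreadLeaf : Fin (2 ^ k) → Fin (2 ^ m)
  spreadLeaf i = leafIndex (spread Z (leaf k i)) (length-spread-leaf i)

  Q : List (Fin (2 ^ m))
  Q = map spreadLeaf (allFin (2 ^ k))

  Q-complete : ∀ a → length a ≡ k → ∃[ i ] (i ∈ₗ Q × leaf m i ≡ spread Z a)
  Q-complete a e = spreadLeaf j , ∈-map⁺ spreadLeaf (∈-allFin j) , (begin
    leaf m (spreadLeaf j)  ≡⟨ leaf-leafIndex (spread Z (leaf k j)) (length-spread-leaf j) ⟩
    spread Z (leaf k j)    ≡⟨ cong (spread Z) (leaf-leafIndex a e) ⟩
    spread Z a             ∎)
    where
    open ≡-Reasoning
    j : Fin (2 ^ k)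
    j = leafIndex a e

  Q-sound : ∀ {i} → i ∈ₗ Q → ∃[ a ] (length a ≡ k × leaf m i ≡ spread Z a)
  Q-sound i∈Q with j , _ , refl ← ∈-map⁻ spreadLeaf i∈Q =
    leaf k j , length-leafPath k (toℕ j) , leaf-leafIndex (spread Z (leaf k j)) (length-spread-leaf j)

  Q≢[] : Q ≢ []
  Q≢[] Q≡[] with Q-complete (replicate k false) (length-replicate k)
  ... | i , i∈Q , _ with () ← subst (i ∈ₗ_) Q≡[] i∈Q

  IsDelta-spread-lcp : ∀ {i j a b} → leaf m i ≡ spread Z a → leaf m j ≡ spread Z b →
    IsDelta (Pair (leaf m i) (leaf m j)) (spread Z (lcp a b))
  IsDelta-spread-lcp {a = a} {b} i↦a j↦b =
    subst₂ (λ p q → IsDelta (Pair p q) (spread Z (lcp a b))) (sym i↦a) (sym j↦b)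
      (subst (IsDelta (Pair (spread Z a) (spread Z b))) (sym (spread-lcp Z a b))
        (IsDelta-Pair-lcp (spread Z a) (spread Z b)))

  image⁺ : ∀ u → length u ≤ k → InV m Q (spread Z u)
  image⁺ u u≤k with a , b , a≡k , b≡k , refl ← fork k u u≤k
    with i , i∈Q , i↦a ← Q-complete a a≡k | j , j∈Q , j↦b ← Q-complete b b≡k =
    i , j , i∈Q , j∈Q , IsDelta-spread-lcp i↦a j↦b

  image⁻ : ∀ x → InV m Q x → ∃[ u ] (length u ≤ k × spread Z u ≡ x)
  image⁻ x (i , j , i∈Q , j∈Q , δ≡x)
    with a , a≡k , i↦a ← Q-sound i∈Q | b , _ , j↦b ← Q-sound j∈Q =
    lcp a b , ≤-trans (Anc-length-≤ (lcp-Ancˡ a b)) (≤-reflexive a≡k) ,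
    IsDelta-unique (inj₁ refl) (IsDelta-spread-lcp i↦a j↦b) δ≡x

  root : IsRoot m Q (spread Z [])
  root = (λ { _ (i , i∈Q , refl) → below-root i∈Q }) , deepest
    where
    below-root : ∀ {i} → i ∈ₗ Q → Anc (spread Z []) (leaf m i)
    below-root i∈Q with a , _ , i↦a ← Q-sound i∈Q =
      subst (Anc (spread Z [])) (sym i↦a) (spread-Anc⁺ Z (Anc-[] a))
    deepest : ∀ y → (∀ s → LeafSet m Q s → Anc y s) → depth y ≤ depth (spread Z [])
    deepest y y-anc with a , b , a≡k , b≡k , lcp≡[] ← fork k [] z≤n
      with i , i∈Q , i↦a ← Q-complete a a≡k | j , j∈Q , j↦b ← Q-complete b b≡k =
      Anc-length-≤ (subst (Anc y) (trans (sym (spread-lcp Z a b)) (cong (spread Z) lcp≡[]))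
        (lcp-greatest _ _ (subst (Anc y) i↦a (y-anc _ (i , i∈Q , refl)))
                          (subst (Anc y) j↦b (y-anc _ (j , j∈Q , refl)))))

  open InducedTree m Q k (spread Z) (spread-injective Z) (spread-Anc⁺ Z) (spread-Anc⁻ Z) image⁺ image⁻
    public using (isPerfect; NonLeafQ-image)

claim3 : (m : ℕ) → 1 ≤ m → (Z : Subset m) →
    ∃[ Q ] (Q ≢ [] × IsPerfectOfHeight m Q ∣ Z ∣
    × (∀ x → NonLeafQ m Q x → DepthIn m Z x))
claim3 m _ Z = Q , Q≢[] , isPerfect root , nonLeaf-depth
  where
  open SpreadTree m Z
  nonLeaf-depth : ∀ x → NonLeafQ m Q x → DepthIn m Z x
  nonLeaf-depth x x-nonLeaf with u , u<k , refl ← NonLeafQ-image x x-nonLeaf = spread-DepthIn Z u u<k
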